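{- Let $k\ge2$, $n\ge2$, $1\le q\le k$, and let $f(x)\in P_1^{k,q}$. For $i=1,\dots,n$ let $a_i,b_i\in E_k$ with $\gcd(a_i,k)=1$ and put $g_i(x_i)=[a_if(x_i)+b_i]\bmod k$. Let $1<t\le n$ and let $j_1,\dots,j_t$ be distinct indices in $\{1,\dots,n\}$ with $\gcd(a_{j_1}+a_{j_2}+\dots+a_{j_t},k)=1$. Let $$h(x_1,\dots,x_n)=[g_1(x_1)+g_2(x_2)+\dots+g_n(x_n)]\bmod k.$$ Then the function obtained from $h$ by identifying the variables $x_{j_1},\dots,x_{j_t}$ (replacing all of them by a single new variable, or by any one of them) is an $H(q)$-function belonging to $P_{n-t+1}^k$.
   Context: $E_k=\{0,1,\dots,k-1\}$; $P_n^k$ is the set of all functions $E_k^n\to E_k$; $P_m^{k,q}$ is the set of functions in $P_m^k$ taking exactly $q$ distinct values. For a variable $x_i$ of a function $f$, $Spr(x_i,f)$ is the set of numbers of distinct values of all one-variable functions obtained from $f$ by fixing all variables other than $x_i$ to constants in $E_k$ (for a one-variable function $g$, $Spr(x,g)=\{Rng(g)\}$, the number of values of $g$). A function is an $H(q)$-function if $Spr(x_i,f)=\{q\}$ for every variable $x_i$ of $f$. "$\bmod k$" denotes the residue in $E_k$. -}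

module Defs where

open import Data.Nat using (ℕ; zero; suc; _+_; _*_; NonZero)
open import Data.Nat.DivMod using (_mod_)
open import Data.Fin using (Fin; toℕ; _≟_)
open import Data.Fin.Properties using (any?)
open import Data.Bool using (if_then_else_)
open import Data.List using (length; filter; allFin; tabulate)
open import Data.Nat.ListAction using (sum)
open import Relation.Nullary.Decidable using (does)
open import Relation.Binary.PropositionalEquality using (_≡_)

rng : ∀ {k} → (Fin k → Fin k) → ℕ
rng {k} g = length (filter (λ y → any? (λ x → g x ≟ y)) (allFin k))

upd : ∀ {k m} → (Fin m → Fin k) → Fin m → Fin k → (Fin m → Fin k)
upd c i x j = if does (j ≟ i) then x else c j

-- F ∈ P_m^k is an H(q)-function: Spr(x_i,F) = {q} for every variable x_i,
-- i.e. every one-variable subfunction in x_i (other variables fixed to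
-- constants) takes exactly q values.
IsH : ∀ (k q m : ℕ) → ((Fin m → Fin k) → Fin k) → Set
IsH k q m F = ∀ (i : Fin m) (c : Fin m → Fin k) → rng (λ x → F (upd c i x)) ≡ q

gfun : ∀ (k : ℕ) .{{_ : NonZero k}} → (Fin k → Fin k) → Fin k → Fin k → Fin k → Fin k
gfun k f a b x = (toℕ a * toℕ (f x) + toℕ b) mod k

hfun : ∀ (k n : ℕ) .{{_ : NonZero k}} → (Fin k → Fin k) → (Fin n → Fin k) → (Fin n → Fin k)
       → (Fin n → Fin k) → Fin k
hfun k n f a b x = sum (tabulate (λ i → toℕ (gfun k f (a i) (b i) (x i)))) mod k

-- Fix every variable of the identified function except one, y.  The variables x_i merged
-- into y are either the block x_{j_1},…,x_{j_t} or a single x_i, so the subfunction is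
-- x ↦ [A·f(x) + B] mod k with A = a_{j_1}+…+a_{j_t} or A = a_i, coprime to k in both cases.
-- Then y ↦ [A·y + B] mod k is injective on E_k, hence a permutation, and composing f with
-- it leaves the number of values, q, unchanged.

module Submission where

open import Defs
open import Data.Bool using (Bool; true; false; if_then_else_)
open import Data.Fin using (Fin; zero; suc; toℕ; _≟_; punchOut)
open import Data.Fin.Permutation using (Permutation′; permutation)
open import Data.Fin.Properties
  using (any?; toℕ-injective; toℕ-fromℕ<; toℕ<n; injective⇒≤; punchOut-injective)
open import Data.List using (length; filter; allFin; tabulate)
open import Data.List.Properties using (filter-≐)
open import Data.Nat using (ℕ; zero; suc; _+_; _*_; _∸_; _≤_; _<_; NonZero)
open import Data.Nat.Coprimality using (gcd≡1⇒coprime; coprime-divisor) renaming (sym to coprime-sym)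
open import Data.Nat.DivMod using (_mod_; _%_; _/_; %-distribˡ-+; m%n%n≡m%n; m≡m%n+[m/n]*n)
open import Data.Nat.Divisibility using (_∣_; divides; ∣m+n∣m⇒∣n; n∣m*n; >⇒∤)
open import Data.Nat.GCD using (gcd)
open import Data.Nat.ListAction using (sum)
open import Data.Nat.Properties
  using (+-*-semiring; +-identityʳ; *-identityˡ; *-identityʳ; +-assoc; +-cancelˡ-≡; ≤-total; ≤-<-trans;
         m≤n+m; m≤n⇒∃[o]m+o≡n; 1+n≰n)
open import Data.Nat.Tactic.RingSolver using (solve-∀)
open import Data.Product using (_×_; ∃; _,_; proj₁; proj₂)
open import Data.Sum using (_⊎_; inj₁; inj₂)
open import Function using (Injective; _⇔_; _∘_; id; mk⇔; Equivalence)
open import Function.Definitions using (StrictlySurjective)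
open import Relation.Binary.PropositionalEquality
  using (_≡_; refl; sym; trans; cong; cong₂; _≗_; module ≡-Reasoning)
open import Relation.Nullary using (does; yes; no; contradiction)
open import Relation.Nullary.Decidable using (does-⇔; dec-false)
open import Relation.Unary using (Pred; Decidable)

open import Algebra.Properties.Semiring.Sum +-*-semiring
  using (sum-syntax; ∑-distrib-+; ∑-comm; *-distribʳ-sum; sum-permute; sum-cong-≗; sum-replicate-zero)

open ≡-Reasoning

indicator : Bool → ℕ
indicator true = 1
indicator false = 0

length-filter-tabulate : ∀ {a p n} {A : Set a} {P : Pred A p} (P? : Decidable P) (g : Fin n → A) →
  length (filter P? (tabulate g)) ≡ ∑[ i < n ] indicator (does (P? (g i)))
length-filter-tabulate {n = zero} P? g = refl
length-filter-tabulate {n = suc n} P? g with does (P? (g zero))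
... | true = cong suc (length-filter-tabulate P? (g ∘ suc))
... | false = length-filter-tabulate P? (g ∘ suc)

injective⇒strictlySurjective : ∀ {k} {φ : Fin k → Fin k} → Injective _≡_ _≡_ φ → StrictlySurjective _≡_ φ
injective⇒strictlySurjective {suc m} {φ} φ-inj z with any? (λ x → φ x ≟ z)
... | yes hit = hit
... | no miss = contradiction (injective⇒≤ punchOut-inj) 1+n≰n
  where
  -- pigeonhole: a missed value z lets φ be squeezed injectively into Fin m
  punchOut-z : Fin (suc m) → Fin m
  punchOut-z x = punchOut {i = z} {j = φ x} (λ z≡φx → miss (x , sym z≡φx))
  punchOut-inj : Injective _≡_ _≡_ punchOut-z
  punchOut-inj {x} {y} = φ-inj ∘ punchOut-injective (λ e → miss (x , sym e)) (λ e → miss (y , sym e))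

count-∘-injective : ∀ {k p} {P : Pred (Fin k) p} (P? : Decidable P) {φ : Fin k → Fin k} → Injective _≡_ _≡_ φ →
  length (filter P? (allFin k)) ≡ length (filter (λ x → P? (φ x)) (allFin k))
count-∘-injective {k} P? {φ} φ-inj = begin
  length (filter P? (allFin k))               ≡⟨ length-filter-tabulate P? id ⟩
  ∑[ z < k ] indicator (does (P? z))          ≡⟨ sum-permute _ π ⟩
  ∑[ x < k ] indicator (does (P? (φ x)))      ≡⟨ length-filter-tabulate (λ x → P? (φ x)) id ⟨
  length (filter (λ x → P? (φ x)) (allFin k)) ∎
  where
  onto : StrictlySurjective _≡_ φ
  onto = injective⇒strictlySurjective φ-inj
  π : Permutation′ k
  π = permutation φ (proj₁ ∘ onto) (proj₂ ∘ onto) (λ x → φ-inj (proj₂ (onto (φ x))))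

rng-cong : ∀ {k} {g h : Fin k → Fin k} → g ≗ h → rng g ≡ rng h
rng-cong {k} {g} {h} g≗h =
  cong length (filter-≐ (λ y → any? λ x → g x ≟ y) (λ y → any? λ x → h x ≟ y) (g⊆h , h⊆g) (allFin k))
  where
  g⊆h : ∀ {y} → ∃ (λ x → g x ≡ y) → ∃ (λ x → h x ≡ y)
  g⊆h (x , gx≡y) = x , trans (sym (g≗h x)) gx≡y
  h⊆g : ∀ {y} → ∃ (λ x → h x ≡ y) → ∃ (λ x → g x ≡ y)
  h⊆g (x , hx≡y) = x , trans (g≗h x) hx≡y

rng-∘-injective : ∀ {k} {φ : Fin k → Fin k} → Injective _≡_ _≡_ φ → (g : Fin k → Fin k) → rng (φ ∘ g) ≡ rng g
rng-∘-injective {k} {φ} φ-inj g = begin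
  rng (φ ∘ g)
    ≡⟨ count-∘-injective (λ y → any? λ x → φ (g x) ≟ y) φ-inj ⟩
  length (filter (λ z → any? λ x → φ (g x) ≟ φ z) (allFin k))
    ≡⟨ cong length (filter-≐ _ _ (φ-cancel , φ-apply) (allFin k)) ⟩
  rng g ∎
  where
  φ-cancel : ∀ {z} → ∃ (λ x → φ (g x) ≡ φ z) → ∃ (λ x → g x ≡ z)
  φ-cancel (x , e) = x , φ-inj e
  φ-apply : ∀ {z} → ∃ (λ x → g x ≡ z) → ∃ (λ x → φ (g x) ≡ φ z)
  φ-apply (x , e) = x , cong φ e

affine : ∀ k .{{_ : NonZero k}} → ℕ → ℕ → Fin k → Fin k
affine k A B y = (A * toℕ y + B) mod k

m%n≡[m+o]%n⇒n∣o : ∀ m o n .{{_ : NonZero n}} → m % n ≡ (m + o) % n → n ∣ o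
m%n≡[m+o]%n⇒n∣o m o n eq = ∣m+n∣m⇒∣n (divides ((m + o) / n) quotients) (n∣m*n (m / n))
  where
  quotients : (m / n) * n + o ≡ ((m + o) / n) * n
  quotients = +-cancelˡ-≡ (m % n) _ _ (begin
    m % n + ((m / n) * n + o)   ≡⟨ +-assoc (m % n) _ o ⟨
    m % n + (m / n) * n + o     ≡⟨ cong (_+ o) (m≡m%n+[m/n]*n m n) ⟨
    m + o                       ≡⟨ m≡m%n+[m/n]*n (m + o) n ⟩
    (m + o) % n + ((m + o) / n) * n ≡⟨ cong (_+ ((m + o) / n) * n) eq ⟨
    m % n + ((m + o) / n) * n   ∎)

affine-injective : ∀ k .{{_ : NonZero k}} A B → gcd A k ≡ 1 → Injective _≡_ _≡_ (affine k A B)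
affine-injective k A B gcd≡1 {x} {y} eq = toℕ-injective (cancel (toℕ<n x) (toℕ<n y) (begin
  (A * toℕ x + B) % k       ≡⟨ toℕ-fromℕ< _ ⟨
  toℕ (affine k A B x)      ≡⟨ cong toℕ eq ⟩
  toℕ (affine k A B y)      ≡⟨ toℕ-fromℕ< _ ⟩
  (A * toℕ y + B) % k       ∎))
  where
  expand : ∀ a b u d → a * (u + d) + b ≡ a * u + b + a * d
  expand = solve-∀
  difference≡0 : ∀ u d → u + d < k → (A * u + B) % k ≡ (A * (u + d) + B) % k → d ≡ 0
  difference≡0 u zero _ _ = refl
  difference≡0 u d@(suc _) u+d<k eq = contradiction k∣d (>⇒∤ (≤-<-trans (m≤n+m d u) u+d<k))
    where
    k∣A*d : k ∣ A * d
    k∣A*d = m%n≡[m+o]%n⇒n∣o (A * u + B) (A * d) k (trans eq (cong (_% k) (expand A B u d)))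
    k∣d : k ∣ d
    k∣d = coprime-divisor (coprime-sym (gcd≡1⇒coprime {A} {k} gcd≡1)) k∣A*d
  cancel-≤ : ∀ {u v} → u ≤ v → v < k → (A * u + B) % k ≡ (A * v + B) % k → u ≡ v
  cancel-≤ {u} u≤v v<k eq with d , refl ← m≤n⇒∃[o]m+o≡n u≤v =
    trans (sym (+-identityʳ u)) (cong (u +_) (sym (difference≡0 u d v<k eq)))
  cancel : ∀ {u v} → u < k → v < k → (A * u + B) % k ≡ (A * v + B) % k → u ≡ v
  cancel {u} {v} u<k v<k eq with ≤-total u v
  ... | inj₁ u≤v = cancel-≤ u≤v v<k eq
  ... | inj₂ v≤u = sym (cancel-≤ v≤u u<k (sym eq))

sum-tabulate : ∀ {n} (g : Fin n → ℕ) → sum (tabulate g) ≡ ∑[ i < n ] g i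
sum-tabulate {zero} g = refl
sum-tabulate {suc n} g = cong (g zero +_) (sum-tabulate (g ∘ suc))

∑-%-cong : ∀ {n} k .{{_ : NonZero k}} {X Y : Fin n → ℕ} → (∀ i → X i % k ≡ Y i % k) →
  (∑[ i < n ] X i) % k ≡ (∑[ i < n ] Y i) % k
∑-%-cong {zero} k X≡Y = refl
∑-%-cong {suc n} k {X} {Y} X≡Y = begin
  (X zero + ∑[ i < n ] X (suc i)) % k                 ≡⟨ %-distribˡ-+ (X zero) _ k ⟩
  (X zero % k + (∑[ i < n ] X (suc i)) % k) % k      ≡⟨ cong₂ (λ u v → (u + v) % k) (X≡Y zero) (∑-%-cong k (X≡Y ∘ suc)) ⟩
  (Y zero % k + (∑[ i < n ] Y (suc i)) % k) % k      ≡⟨ %-distribˡ-+ (Y zero) _ k ⟨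
  (Y zero + ∑[ i < n ] Y (suc i)) % k                 ∎

∑-select : ∀ {n} (a : Fin n) (w : Fin n → ℕ) → ∑[ i < n ] (indicator (does (a ≟ i)) * w i) ≡ w a
∑-select {suc n} zero w = trans (cong₂ _+_ (*-identityˡ (w zero)) (sum-replicate-zero n)) (+-identityʳ (w zero))
∑-select (suc a) w = ∑-select a (w ∘ suc)

∑-indicator-⇔ : ∀ {n p q} {P : Pred (Fin n) p} {Q : Pred (Fin n) q} (P? : Decidable P) (Q? : Decidable Q) →
  (∀ i → P i ⇔ Q i) → (w : Fin n → ℕ) →
  ∑[ i < n ] (indicator (does (P? i)) * w i) ≡ ∑[ i < n ] (indicator (does (Q? i)) * w i)
∑-indicator-⇔ P? Q? P⇔Q w = sum-cong-≗ λ i → cong (λ e → indicator e * w i) (does-⇔ (P⇔Q i) (P? i) (Q? i))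

∑-image : ∀ {n t} {j : Fin t → Fin n} → Injective _≡_ _≡_ j → (w : Fin n → ℕ) →
  ∑[ i < n ] (indicator (does (any? λ s → j s ≟ i)) * w i) ≡ ∑[ s < t ] w (j s)
∑-image {n} {t} {j} j-inj w = sym (begin
  ∑[ s < t ] w (j s)
    ≡⟨ sum-cong-≗ (λ s → ∑-select (j s) w) ⟨
  ∑[ s < t ] ∑[ i < n ] (indicator (does (j s ≟ i)) * w i)
    ≡⟨ ∑-comm (λ s i → indicator (does (j s ≟ i)) * w i) ⟩
  ∑[ i < n ] ∑[ s < t ] (indicator (does (j s ≟ i)) * w i)
    ≡⟨ sum-cong-≗ (λ i → *-distribʳ-sum (w i) (λ s → indicator (does (j s ≟ i)))) ⟨
  ∑[ i < n ] ((∑[ s < t ] indicator (does (j s ≟ i))) * w i)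
    ≡⟨ sum-cong-≗ (λ i → cong (_* w i) (hits i)) ⟩
  ∑[ i < n ] (indicator (does (any? λ s → j s ≟ i)) * w i) ∎)
  where
  hits : ∀ i → ∑[ s < t ] indicator (does (j s ≟ i)) ≡ indicator (does (any? λ s → j s ≟ i))
  hits i with any? (λ s → j s ≟ i)
  ... | yes (s₀ , refl) = begin
    ∑[ s < t ] indicator (does (j s ≟ j s₀))
      ≡⟨ sum-cong-≗ (λ s → *-identityʳ (indicator (does (j s ≟ j s₀)))) ⟨
    ∑[ s < t ] (indicator (does (j s ≟ j s₀)) * 1)
      ≡⟨ ∑-indicator-⇔ (λ s → j s ≟ j s₀) (s₀ ≟_) j-cancel (λ _ → 1) ⟩
    ∑[ s < t ] (indicator (does (s₀ ≟ s)) * 1)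
      ≡⟨ ∑-select s₀ (λ _ → 1) ⟩
    1 ∎
    where
    j-cancel : ∀ s → (j s ≡ j s₀) ⇔ (s₀ ≡ s)
    j-cancel s = mk⇔ (sym ∘ j-inj) (cong j ∘ sym)
  ... | no miss = trans (sum-cong-≗ (λ s → cong indicator (dec-false (j s ≟ i) (miss ∘ (s ,_))))) (sum-replicate-zero t)

∑-fibre : ∀ {n m t} {j : Fin t → Fin n} → Injective _≡_ _≡_ j → (σ : Fin n → Fin m) →
  (∀ i i′ → (σ i ≡ σ i′) ⇔ (i ≡ i′ ⊎ ((∃ λ s → j s ≡ i) × (∃ λ s → j s ≡ i′)))) →
  (w : Fin n → ℕ) (i₀ : Fin n) →
  (∑[ i < n ] (indicator (does (σ i ≟ σ i₀)) * w i) ≡ ∑[ s < t ] w (j s))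
    ⊎ (∑[ i < n ] (indicator (does (σ i ≟ σ i₀)) * w i) ≡ w i₀)
∑-fibre {j = j} j-inj σ σ-fibres w i₀ with any? (λ s → j s ≟ i₀)
... | yes hit₀ =
  inj₁ (trans (∑-indicator-⇔ (λ i → σ i ≟ σ i₀) (λ i → any? λ s → j s ≟ i) fibre⇔image w) (∑-image j-inj w))
  where
  fibre⇔image : ∀ i → (σ i ≡ σ i₀) ⇔ (∃ λ s → j s ≡ i)
  fibre⇔image i = mk⇔ to (λ hit → Equivalence.from (σ-fibres i i₀) (inj₂ (hit , hit₀)))
    where
    to : σ i ≡ σ i₀ → ∃ λ s → j s ≡ i
    to σi≡σi₀ with Equivalence.to (σ-fibres i i₀) σi≡σi₀
    ... | inj₁ refl = hit₀
    ... | inj₂ (hit , _) = hit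
... | no miss₀ =
  inj₂ (trans (∑-indicator-⇔ (λ i → σ i ≟ σ i₀) (i₀ ≟_) fibre⇔point w) (∑-select i₀ w))
  where
  fibre⇔point : ∀ i → (σ i ≡ σ i₀) ⇔ (i₀ ≡ i)
  fibre⇔point i = mk⇔ to (λ { refl → refl })
    where
    to : σ i ≡ σ i₀ → i₀ ≡ i
    to σi≡σi₀ with Equivalence.to (σ-fibres i i₀) σi≡σi₀
    ... | inj₁ i≡i₀ = sym i≡i₀
    ... | inj₂ (_ , hit₀) = contradiction hit₀ miss₀

gfun-if-% : ∀ k .{{_ : NonZero k}} (f : Fin k → Fin k) (β : Bool) (a b x y : Fin k) →
  toℕ (gfun k f a b (if β then x else y)) % k
    ≡ (indicator β * toℕ a * toℕ (f x) + (if β then toℕ b else toℕ (gfun k f a b y))) % k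
gfun-if-% k f true a b x y = begin
  toℕ ((toℕ a * toℕ (f x) + toℕ b) mod k) % k  ≡⟨ cong (_% k) (toℕ-fromℕ< _) ⟩
  (toℕ a * toℕ (f x) + toℕ b) % k % k          ≡⟨ m%n%n≡m%n _ k ⟩
  (toℕ a * toℕ (f x) + toℕ b) % k              ≡⟨ cong (λ m → (m * toℕ (f x) + toℕ b) % k) (*-identityˡ (toℕ a)) ⟨
  (1 * toℕ a * toℕ (f x) + toℕ b) % k          ∎
gfun-if-% k f false a b x y = refl

hfun-if : ∀ k n .{{_ : NonZero k}} (f : Fin k → Fin k) (a b : Fin n → Fin k)
  (d : Fin n → Bool) (y : Fin n → Fin k) (x : Fin k) →
  hfun k n f a b (λ i → if d i then x else y i)
    ≡ affine k (∑[ i < n ] (indicator (d i) * toℕ (a i)))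
               (∑[ i < n ] (if d i then toℕ (b i) else toℕ (gfun k f (a i) (b i) (y i))))
               (f x)
hfun-if k n f a b d y x = toℕ-injective (begin
  toℕ (hfun k n f a b (λ i → if d i then x else y i))
    ≡⟨ toℕ-fromℕ< _ ⟩
  sum (tabulate G) % k
    ≡⟨ cong (_% k) (sum-tabulate G) ⟩
  (∑[ i < n ] G i) % k
    ≡⟨ ∑-%-cong k (λ i → gfun-if-% k f (d i) (a i) (b i) x (y i)) ⟩
  (∑[ i < n ] (α i * toℕ (f x) + C i)) % k
    ≡⟨ cong (_% k) (∑-distrib-+ _ C) ⟩
  (∑[ i < n ] (α i * toℕ (f x)) + B) % k
    ≡⟨ cong (λ m → (m + B) % k) (*-distribʳ-sum (toℕ (f x)) α) ⟨
  (A * toℕ (f x) + B) % k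
    ≡⟨ toℕ-fromℕ< _ ⟨
  toℕ (affine k A B (f x)) ∎)
  where
  G C α : Fin n → ℕ
  G i = toℕ (gfun k f (a i) (b i) (if d i then x else y i))
  C i = if d i then toℕ (b i) else toℕ (gfun k f (a i) (b i) (y i))
  α i = indicator (d i) * toℕ (a i)
  A B : ℕ
  A = ∑[ i < n ] α i
  B = ∑[ i < n ] C i

theorem2p3 : (k n q : ℕ) .{{_ : NonZero k}} → 2 ≤ k → 2 ≤ n → 1 ≤ q → q ≤ k
    → (f : Fin k → Fin k) → rng f ≡ q
    → (a b : Fin n → Fin k) → (∀ i → gcd (toℕ (a i)) k ≡ 1)
    → (t : ℕ) → 2 ≤ t → t ≤ n
    → (j : Fin t → Fin n) → Injective _≡_ _≡_ j
    → gcd (sum (tabulate (λ s → toℕ (a (j s))))) k ≡ 1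
    → (σ : Fin n → Fin (suc (n ∸ t)))
    → (∀ y → ∃ λ i → σ i ≡ y)
    → (∀ i i′ → (σ i ≡ σ i′) ⇔ (i ≡ i′ ⊎ ((∃ λ s → j s ≡ i) × (∃ λ s → j s ≡ i′))))
    → IsH k q (suc (n ∸ t)) (λ y → hfun k n f a b (λ i → y (σ i)))
theorem2p3 k n q _ _ _ _ f rng-f≡q a b a-coprime t _ _ j j-inj ∑a∘j-coprime σ σ-onto σ-fibres p c
  with i₀ , refl ← σ-onto p = begin
    -- upd c (σ i₀) x (σ i) unfolds to: if d i then x else c (σ i)
    rng (λ x → hfun k n f a b (λ i → upd c (σ i₀) x (σ i)))  ≡⟨ rng-cong (hfun-if k n f a b d (c ∘ σ)) ⟩
    rng (affine k A B ∘ f)                                  ≡⟨ rng-∘-injective (affine-injective k A B A-coprime) f ⟩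
    rng f                                                   ≡⟨ rng-f≡q ⟩
    q                                                       ∎
  where
  d : Fin n → Bool
  d i = does (σ i ≟ σ i₀)
  A B : ℕ
  A = ∑[ i < n ] (indicator (d i) * toℕ (a i))
  B = ∑[ i < n ] (if d i then toℕ (b i) else toℕ (gfun k f (a i) (b i) (c (σ i))))
  A-coprime : gcd A k ≡ 1
  A-coprime with ∑-fibre j-inj σ σ-fibres (toℕ ∘ a) i₀
  ... | inj₁ A≡∑a∘j =
    trans (cong (λ m → gcd m k) (trans A≡∑a∘j (sym (sum-tabulate (toℕ ∘ a ∘ j))))) ∑a∘j-coprime
  ... | inj₂ A≡a₀ = trans (cong (λ m → gcd m k) A≡a₀) (a-coprime i₀)
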